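{- Let $A$ and $B$ be related strings, let $G=(V_A\uplus V_B,E)$ be their duo graph, let $M$ be a maximum matching of $G$, and let $M_A\subseteq V_A$ (resp. $M_B\subseteq V_B$) be the set of vertices of $V_A$ (resp. $V_B$) that are endpoints of an edge of $M$. Let $a,b\in\Sigma$ be symbols and assume there exist preservable duos of $A$ and $B$ whose corresponding string is $ab$. Then at most one of the sets $V_A\setminus M_A$ and $V_B\setminus M_B$ contains a vertex associated with a duo whose corresponding string is $ab$.
   Context: For a string $S$ over alphabet $\Sigma$, $S[i]$ denotes its $i$-th symbol. A duo of $S$ is an ordered pair of consecutive symbols $(S[i],S[i+1])$, $1\le i\le |S|-1$; its corresponding string is $S[i]S[i+1]$. Two strings are related if one is a permutation of the other. A duo $(A[i],A[i+1])$ of $A$ and a duo $(B[j],B[j+1])$ of $B$ are preservable if $A[i]=B[j]$ and $A[i+1]=B[j+1]$. The duo graph of $A$ and $B$ is the bipartite graph $G=(V_A\uplus V_B,E)$ with one vertex in $V_A$ for each duo of $A$, one vertex in $V_B$ for each duo of $B$, and an edge between $v_a\in V_A$ and $v_b\in V_B$ iff the corresponding duos are preservable. -}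

module Defs where

open import Level using (Level)
open import Data.Nat using (ℕ; _≤_)
open import Data.Fin using (Fin)
open import Data.Product using (Σ; ∃; _×_; _,_; proj₁; proj₂)
open import Data.List using (List; []; _∷_; length; map; lookup)
open import Data.List.Relation.Unary.All using (All)
open import Data.List.Relation.Unary.Unique.Propositional using (Unique)
open import Data.List.Membership.Propositional using (_∈_)
open import Data.List.Relation.Binary.Permutation.Propositional using (_↭_)
open import Relation.Binary.PropositionalEquality using (_≡_)
open import Relation.Nullary using (¬_)

duos : ∀ {ℓ} {Σ : Set ℓ} → List Σ → List (Σ × Σ)
duos []           = []
duos (x ∷ [])     = []
duos (x ∷ y ∷ xs) = (x , y) ∷ duos (y ∷ xs)

module _ {ℓ} {Σ : Set ℓ} where

  Related : List Σ → List Σ → Set ℓ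
  Related A B = A ↭ B

  -- Vertices of the duo graph: V_A = duo positions of A, V_B = duo positions of B.
  VA : List Σ → Set
  VA A = Fin (length (duos A))

  duo : (S : List Σ) → VA S → Σ × Σ
  duo S i = lookup (duos S) i

  -- Edge of the duo graph: duos are preservable (same symbols in the same order).
  Preservable : (A B : List Σ) → VA A → VA B → Set ℓ
  Preservable A B i j = duo A i ≡ duo B j

  record Matching (A B : List Σ) : Set ℓ where
    field
      edges    : List (VA A × VA B)
      isEdge   : All (λ e → Preservable A B (proj₁ e) (proj₂ e)) edges
      uniqueA  : Unique (map proj₁ edges)
      uniqueB  : Unique (map proj₂ edges)

  open Matching public

  size : ∀ {A B} → Matching A B → ℕ
  size M = length (edges M)

  MaximumMatching : ∀ {A B} → Matching A B → Set ℓ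
  MaximumMatching {A} {B} M = (M′ : Matching A B) → size M′ ≤ size M

  InMA : ∀ {A B} → Matching A B → VA A → Set
  InMA {A} {B} M i = ∃ λ (j : VA B) → (i , j) ∈ edges M

  InMB : ∀ {A B} → Matching A B → VA B → Set
  InMB {A} {B} M j = ∃ λ (i : VA A) → (i , j) ∈ edges M

-- An unmatched vertex of V_A and an unmatched vertex of V_B whose duos are
-- both ab are joined by an edge of the duo graph; adding that edge to M
-- gives a larger matching, contradicting maximality.
module Submission where

open import Defs
open import Level using (Level)
open import Data.List using (List; _∷_; map)
open import Data.List.Relation.Unary.All using (All; _∷_; tabulate)
open import Data.List.Relation.Unary.AllPairs using (_∷_)
open import Data.List.Membership.Propositional using (_∈_; _∉_)
open import Data.List.Membership.Propositional.Properties using (∈-map⁻)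
open import Data.Empty using (⊥)
open import Data.Nat.Properties using (n≮n)
open import Data.Product using (∃; _×_; _,_; proj₁; proj₂)
open import Relation.Binary.PropositionalEquality using (_≡_; _≢_; refl; sym; trans)
open import Relation.Nullary using (¬_)

private
  variable
    ℓ₁ ℓ₂ : Level
    X : Set ℓ₁
    Y : Set ℓ₂

∉-map-proj₁ : (es : List (X × Y)) {x : X} →
              ¬ (∃ λ y → (x , y) ∈ es) → All (x ≢_) (map proj₁ es)
∉-map-proj₁ es {x} x-free = tabulate λ x∈ x≡ → case (∈-map⁻ proj₁ x∈) x≡
  where
  case : ∀ {x′} → (∃ λ e → e ∈ es × x′ ≡ proj₁ e) → x ≡ x′ → ⊥
  case ((_ , y) , e∈ , refl) refl = x-free (y , e∈)

∉-map-proj₂ : (es : List (X × Y)) {y : Y} →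
              ¬ (∃ λ x → (x , y) ∈ es) → All (y ≢_) (map proj₂ es)
∉-map-proj₂ es {y} y-free = tabulate λ y∈ y≡ → case (∈-map⁻ proj₂ y∈) y≡
  where
  case : ∀ {y′} → (∃ λ e → e ∈ es × y′ ≡ proj₂ e) → y ≡ y′ → ⊥
  case ((x , _) , e∈ , refl) refl = y-free (x , e∈)

module _ {ℓ} {Σ : Set ℓ} {A B : List Σ} where

  addEdge : (M : Matching A B) {i : VA A} {j : VA B} →
            ¬ InMA M i → ¬ InMB M j → Preservable A B i j → Matching A B
  addEdge M {i} {j} i-free j-free i∼j = record
    { edges   = (i , j) ∷ edges M
    ; isEdge  = i∼j ∷ isEdge M
    ; uniqueA = ∉-map-proj₁ (edges M) i-free ∷ uniqueA M
    ; uniqueB = ∉-map-proj₂ (edges M) j-free ∷ uniqueB M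
    }

  maximum⇒¬free-edge : (M : Matching A B) → MaximumMatching M →
                       {i : VA A} {j : VA B} →
                       ¬ InMA M i → ¬ InMB M j → ¬ Preservable A B i j
  maximum⇒¬free-edge M max i-free j-free i∼j =
    n≮n (size M) (max (addEdge M i-free j-free i∼j))

lemma4 : ∀ {ℓ} {Σ : Set ℓ} (A B : List Σ) → Related A B
    → (M : Matching A B) → MaximumMatching M
    → (a b : Σ)
    → (∃ λ (i : VA A) → ∃ λ (j : VA B) → Preservable A B i j × duo A i ≡ (a , b) × duo B j ≡ (a , b))
    → ¬ ((∃ λ (i : VA A) → ¬ InMA M i × duo A i ≡ (a , b))
       × (∃ λ (j : VA B) → ¬ InMB M j × duo B j ≡ (a , b)))
lemma4 A B _ M max a b _ ((i , i-free , i≡ab) , (j , j-free , j≡ab)) =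
  maximum⇒¬free-edge M max i-free j-free (trans i≡ab (sym j≡ab))
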